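{- Let $u$ be a vertex of a graph $G$, let $X=N_G(u)$ and $A=V(G)\setminus N_G[u]$. In any vertex incremental minimal triangulation $H(A,u,X)$ of $G$, no fill edge is incident to $u$.
   Context: All graphs are finite, simple and undirected. A graph is chordal if it has no induced cycle of length more than three. $H=(V,E\cup F)$ with $F\cap E=\emptyset$ is a minimal triangulation of $G=(V,E)$ if $H$ is chordal and no $(V,E\cup F')$ with $F'\subsetneq F$ is chordal; edges of $F$ are fill edges. Given a vertex ordering $(v_1,\dots,v_n)$ of $G$, a vertex incremental minimal triangulation $H(v_1,\dots,v_n)$ is obtained by computing, for $i=1,\dots,n$, a minimal triangulation $H_i$ of $G_i=G[\{v_1,\dots,v_i\}]$ from the minimal triangulation $H_{i-1}$ of $G_{i-1}$ by adding only edges incident to $v_i$ (so $H_i-v_i=H_{i-1}$), and setting $H=H_n$. $H(A,u,X)$ denotes such a triangulation for an ordering that lists the vertices of $A$ first (in any order), then $u$, then the vertices of $X$ (in any order). -}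

module Defs where

open import Data.Nat using (ℕ; zero; suc; _≤_; _<_)
open import Data.Fin using (Fin; toℕ)
open import Data.Bool using (Bool; true; false)
open import Data.Product using (Σ; _×_; ∃)
open import Data.Sum using (_⊎_)
open import Relation.Nullary using (¬_)
open import Relation.Binary.PropositionalEquality using (_≡_)
open import Function.Definitions using (Injective)

record SimpleGraph (n : ℕ) : Set where
  field
    adj    : Fin n → Fin n → Bool
    sym    : ∀ x y → adj x y ≡ adj y x
    irrefl : ∀ x → adj x x ≡ false
open SimpleGraph public

-- A vertex subset, used to speak about induced subgraphs G[S].
VSet : ℕ → Set₁
VSet n = Fin n → Set

CycAdj : (k : ℕ) → Fin k → Fin k → Set
CycAdj k i j =
  (suc (toℕ i) ≡ toℕ j) ⊎ (suc (toℕ j) ≡ toℕ i)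
  ⊎ ((toℕ i ≡ 0 × suc (toℕ j) ≡ k) ⊎ (toℕ j ≡ 0 × suc (toℕ i) ≡ k))

record InducedLongCycle {n : ℕ} (G : SimpleGraph n) (S : VSet n) : Set where
  field
    k      : ℕ
    long   : 4 ≤ k
    c      : Fin k → Fin n
    inj    : Injective _≡_ _≡_ c
    inS    : ∀ i → S (c i)
    edges  : ∀ i j → CycAdj k i j → adj G (c i) (c j) ≡ true
    chords : ∀ i j → adj G (c i) (c j) ≡ true → CycAdj k i j

Chordal : ∀ {n} → SimpleGraph n → VSet n → Set
Chordal G S = ¬ InducedLongCycle G S

_⊆ᴱ_ : ∀ {n} → SimpleGraph n → SimpleGraph n → Set
G ⊆ᴱ H = ∀ x y → adj G x y ≡ true → adj H x y ≡ true

-- H (a graph on Fin n whose edges all lie inside S) is a minimal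
-- triangulation of the induced subgraph G[S]:
--  * H has vertex set S (no edges leaving S), contains all edges of G[S],
--  * H[S] is chordal,
--  * no H' = (S, E(G[S]) ∪ F') with F' ⊊ F = E(H) \ E(G[S]) is chordal.
record MinimalTriangulation {n : ℕ} (G H : SimpleGraph n) (S : VSet n) : Set₁ where
  field
    insideS  : ∀ x y → adj H x y ≡ true → S x × S y
    supgraph : ∀ x y → S x → S y → adj G x y ≡ true → adj H x y ≡ true
    chordal  : Chordal H S
    minimal  : ∀ (H' : SimpleGraph n) →
               (∀ x y → S x → S y → adj G x y ≡ true → adj H' x y ≡ true) →
               H' ⊆ᴱ H → ¬ (H ⊆ᴱ H') → ¬ Chordal H' S

-- The ordering (v_1,…,v_n) is given by the position map pos (a bijection
-- Fin n → Fin n, v has position toℕ (pos v), 0-based).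
-- Prefix pos i = {v_1,…,v_i}.
Prefix : ∀ {n} → (Fin n → Fin n) → ℕ → VSet n
Prefix pos i v = toℕ (pos v) < i

-- Hs i is the graph H_i (on vertex set {v_1,…,v_i}), for 0 ≤ i ≤ n.  The result is H = Hs n.
record VertexIncrementalMT {n : ℕ} (G : SimpleGraph n) (pos : Fin n → Fin n)
                           (Hs : ℕ → SimpleGraph n) : Set₁ where
  field
    minTri      : ∀ i → i ≤ n → MinimalTriangulation G (Hs i) (Prefix pos i)
    incremental : ∀ i → i < n → ∀ x y → Prefix pos i x → Prefix pos i y →
                  adj (Hs (suc i)) x y ≡ adj (Hs i) x y

-- When u is inserted, none of its G-neighbours is present yet, so u is isolated in
-- G_u; deleting all edges at u from H_u then leaves a chordal graph that still
-- contains G_u, and minimality forbids H_u from having any such edge. Every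
-- non-neighbour of u precedes u, and later steps never change edges among
-- earlier vertices, so u never acquires a fill edge.
module Submission where

open import Defs hiding (sym)
open import Data.Nat using (ℕ; suc; s≤s⁻¹; _≤′_; ≤′-refl; ≤′-step; _<?_)
  renaming (_≤_ to _≤ℕ_)
open import Data.Nat.Properties
  using (≤-refl; <-≤-trans; ≤-antisym; ≮⇒≥; <⇒≱; m<n⇒m<1+n; ≤′⇒≤; ≤⇒≤′; <⇒≤)
import Data.Fin as Fin
open import Data.Fin using (Fin; _<_; toℕ; fromℕ<; _≟_)
open import Data.Fin.Properties using (toℕ<n; toℕ-fromℕ<)
open import Data.Bool using (true; false; not; _∧_; _∨_)
open import Data.Bool.Properties using (∨-comm; ∧-zeroʳ; ¬-not)
open import Data.Product using (Σ; _,_)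
open import Data.Sum using (inj₁; inj₂)
open import Relation.Nullary using (¬_; yes; no; does; contradiction)
open import Relation.Nullary.Decidable using (dec-true; dec-false)
open import Relation.Binary.PropositionalEquality
  using (_≡_; _≢_; refl; sym; trans; cong; cong₂)
open import Function.Definitions using (Injective)

private
  variable
    n : ℕ

cyclic-successor : ∀ {k} (i : Fin k) → Σ (Fin k) (CycAdj k i)
cyclic-successor {suc k} i with suc (toℕ i) <? suc k
... | yes i+1<k = fromℕ< i+1<k , inj₁ (sym (toℕ-fromℕ< i+1<k))
... | no i+1≮k  = Fin.zero , inj₂ (inj₂ (inj₂ (refl , ≤-antisym (toℕ<n i) (≮⇒≥ i+1≮k))))

isolate : Fin n → SimpleGraph n → SimpleGraph n
isolate u H = record
  { adj    = λ x y → not (does (x ≟ u) ∨ does (y ≟ u)) ∧ adj H x y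
  ; sym    = λ x y → cong₂ _∧_ (cong not (∨-comm (does (x ≟ u)) _)) (SimpleGraph.sym H x y)
  ; irrefl = λ x → trans (cong (_ ∧_) (irrefl H x)) (∧-zeroʳ _)
  }

module _ (u : Fin n) (H : SimpleGraph n) where

  isolate-⊆ : isolate u H ⊆ᴱ H
  isolate-⊆ x y e with does (x ≟ u) ∨ does (y ≟ u)
  ... | false = e

  isolate-adj : ∀ {x y} → x ≢ u → y ≢ u → adj (isolate u H) x y ≡ adj H x y
  isolate-adj {x} {y} x≢u y≢u rewrite dec-false (x ≟ u) x≢u | dec-false (y ≟ u) y≢u = refl

  isolate-adjˡ : ∀ y → adj (isolate u H) u y ≡ false
  isolate-adjˡ y rewrite dec-true (u ≟ u) refl = refl

  chordal-isolate : ∀ {S} → Chordal H S → Chordal (isolate u H) S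
  chordal-isolate chordal C = chordal record
    { k = k ; long = long ; c = c ; inj = inj ; inS = inS
    ; edges  = λ i j ij → trans (sym (agrees i j)) (edges i j ij)
    ; chords = λ i j e → chords i j (trans (agrees i j) e)
    }
    where
    open InducedLongCycle C

    avoids : ∀ i → c i ≢ u
    avoids i cᵢ≡u with cyclic-successor i
    ... | j , ij = contradiction (trans (sym (edges i j ij)) isolated) λ ()
      where
      isolated : adj (isolate u H) (c i) (c j) ≡ false
      isolated rewrite cᵢ≡u = isolate-adjˡ (c j)

    agrees : ∀ i j → adj (isolate u H) (c i) (c j) ≡ adj H (c i) (c j)
    agrees i j = isolate-adj (avoids i) (avoids j)

minimal-triangulation-isolated :
  ∀ {G H : SimpleGraph n} {S : VSet n} → MinimalTriangulation G H S →
  ∀ u → (∀ x → adj G u x ≡ true → ¬ S x) → ∀ w → adj H u w ≢ true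
minimal-triangulation-isolated {G = G} {H} {S} mt u isolatedᴳ w uw∈H =
  minimal (isolate u H) keepsG (isolate-⊆ u H) notSuper (chordal-isolate u H chordal)
  where
  open MinimalTriangulation mt

  keepsG : ∀ x y → S x → S y → adj G x y ≡ true → adj (isolate u H) x y ≡ true
  keepsG x y x∈S y∈S xy∈G with x ≟ u | y ≟ u
  ... | yes refl | _       = contradiction y∈S (isolatedᴳ y xy∈G)
  ... | no _     | yes refl = contradiction x∈S (isolatedᴳ x (trans (SimpleGraph.sym G u x) xy∈G))
  ... | no _     | no _     = supgraph x y x∈S y∈S xy∈G

  notSuper : ¬ (H ⊆ᴱ isolate u H)
  notSuper H⊆ = contradiction (trans (sym (H⊆ u w uw∈H)) (isolate-adjˡ u H w)) λ ()

module _ {G : SimpleGraph n} {pos : Fin n → Fin n} {Hs : ℕ → SimpleGraph n}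
         (vimt : VertexIncrementalMT G pos Hs) where

  open VertexIncrementalMT vimt

  incremental-stable : ∀ {i j x y} → i ≤′ j → j ≤ℕ n →
                       Prefix pos i x → Prefix pos i y →
                       adj (Hs j) x y ≡ adj (Hs i) x y
  incremental-stable ≤′-refl _ _ _ = refl
  incremental-stable {i} {suc j} {x} {y} (≤′-step i≤′j) j<n x∈ y∈ =
    trans (incremental j j<n x y (grow x∈) (grow y∈))
          (incremental-stable i≤′j (<⇒≤ j<n) x∈ y∈)
    where
    grow : ∀ {v} → Prefix pos i v → Prefix pos j v
    grow v∈ = <-≤-trans v∈ (≤′⇒≤ i≤′j)

lemma15 : ∀ {n : ℕ} (G : SimpleGraph n) (u : Fin n)
          (pos : Fin n → Fin n) → Injective _≡_ _≡_ pos →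
          (∀ a → a ≢ u → adj G u a ≡ false → pos a < pos u) →
          (∀ x → adj G u x ≡ true → pos u < pos x) →
          (Hs : ℕ → SimpleGraph n) → VertexIncrementalMT G pos Hs →
          ∀ w → adj (Hs n) u w ≡ true → adj G u w ≡ true
lemma15 {n} G u pos _ before after Hs vimt w uw∈Hₙ = ¬-not uw∉G-absurd
  where
  p = suc (toℕ (pos u))

  isolated-in-Hₚ : ∀ v → adj (Hs p) u v ≢ true
  isolated-in-Hₚ = minimal-triangulation-isolated
    (VertexIncrementalMT.minTri vimt p (toℕ<n (pos u))) u
    (λ x ux∈G x∈Prefixₚ → <⇒≱ (after x ux∈G) (s≤s⁻¹ x∈Prefixₚ))

  uw∉G-absurd : adj G u w ≢ false
  uw∉G-absurd uw∉G with w ≟ u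
  ... | yes refl = contradiction (trans (sym uw∈Hₙ) (irrefl (Hs n) u)) λ ()
  ... | no w≢u   = isolated-in-Hₚ w (trans (sym unchanged) uw∈Hₙ)
    where
    unchanged : adj (Hs n) u w ≡ adj (Hs p) u w
    unchanged = incremental-stable vimt (≤⇒≤′ (toℕ<n (pos u))) ≤-refl
                  ≤-refl (m<n⇒m<1+n (before w w≢u uw∉G))
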